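{- Let $n\in\mathbb{N}$, $\pi=\pi_1\cdots\pi_n\in S_n$ and $k\ge0$. Then $s^k(\pi_1\pi_2\cdots\pi_{n-1})$ occurs as a (not necessarily contiguous) subsequence of $s^k(\pi)$.
   Context: West's stack-sorting map $s$ acts on a finite sequence of distinct integers as follows: read the input from left to right with an initially empty stack; repeatedly, if the input is nonempty and either the stack is empty or the top element of the stack is greater than the next input entry, push the next input entry onto the stack; otherwise pop the top element of the stack and append it to the output; stop when both input and stack are empty. $s$ of the empty sequence is empty. $S_n$ is the set of permutations of $[n]$ in one-line notation. -}

module Defs where

open import Data.Nat using (ℕ; zero; suc; _<ᵇ_)
open import Data.Bool using (if_then_else_)
open import Data.List using (List; []; _∷_; _++_)

-- West's stack-sorting map s, following the stack algorithm literally.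
-- State: remaining input, stack (head = top of stack), output so far.

mutual
  run : List ℕ → List ℕ → List ℕ → List ℕ
  run []       st out = out ++ st
  run (x ∷ xs) st out = pops x xs st out

  pops : ℕ → List ℕ → List ℕ → List ℕ → List ℕ
  pops x xs []       out = run xs (x ∷ []) out
  pops x xs (t ∷ st) out =
    if x <ᵇ t then run xs (x ∷ t ∷ st) out
              else pops x xs st (out ++ t ∷ [])

s : List ℕ → List ℕ
s w = run w [] []

iter : ℕ → (List ℕ → List ℕ) → List ℕ → List ℕ
iter zero    f w = w
iter (suc k) f w = f (iter k f w)

dropLast : List ℕ → List ℕ
dropLast []           = []
dropLast (x ∷ [])     = []
dropLast (x ∷ y ∷ xs) = x ∷ dropLast (y ∷ xs)

oneTo : ℕ → List ℕ
oneTo zero    = []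
oneTo (suc n) = oneTo n ++ suc n ∷ []

{-# OPTIONS --safe #-}
-- Call x a right-to-left minimum of w = u ++ x ∷ v if x is smaller than every
-- entry of v.  Deleting such an entry commutes with s: s (u ++ v) is s w with x
-- deleted, and x is again a right-to-left minimum of s w.  Indeed, the two runs
-- of the stack algorithm agree until x arrives; the entries x pops are also
-- popped by the next entry of v, which is larger than x; x is then pushed and
-- leaves the stack at the very next step, after which the runs agree again.
-- Everything output after x is either later input or lies below x in the
-- stack, hence is larger than x.  Iterating, and noting that the last entry of
-- any word is a right-to-left minimum, gives the theorem.
module Submission where

open import Defs
open import Data.Nat using (ℕ; zero; suc; _<ᵇ_; _<_)
open import Data.Nat.Properties using (<ᵇ-reflects-<; <-asym; <-trans; ≤-<-trans; ≮⇒≥)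
open import Data.Bool using (true; false)
open import Data.List using (List; []; _∷_; _++_; initLast; _∷ʳ′_)
open import Data.List.Properties using (++-assoc; ++-identityʳ)
open import Data.List.Relation.Unary.All as All using (All; []; _∷_)
open import Data.List.Relation.Unary.All.Properties using (++⁺)
open import Data.List.Relation.Unary.AllPairs using (AllPairs; []; _∷_)
open import Data.List.Relation.Binary.Permutation.Propositional using (_↭_)
open import Data.List.Relation.Binary.Sublist.Propositional using (_⊆_; ⊆-refl; _∷ʳ_)
import Data.List.Relation.Binary.Sublist.Propositional.Properties as Sublist
open import Relation.Nullary using (contradiction)
open import Relation.Nullary.Reflects using (ofʸ; ofⁿ)
open import Relation.Binary.PropositionalEquality
  using (_≡_; refl; sym; trans; cong; subst; module ≡-Reasoning)

record RLMinDeletion (x : ℕ) (w′ w : List ℕ) : Set where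
  constructor split
  field
    prefix suffix : List ℕ
    w≡            : w ≡ prefix ++ x ∷ suffix
    w′≡           : w′ ≡ prefix ++ suffix
    x<suffix      : All (x <_) suffix

RLMinDeletion⇒⊆ : ∀ {x w′ w} → RLMinDeletion x w′ w → w′ ⊆ w
RLMinDeletion⇒⊆ (split u v refl refl _) = Sublist.++⁺ ⊆-refl (_ ∷ʳ ⊆-refl)

mutual
  run-prefix : ∀ w st o p → run w st (o ++ p) ≡ o ++ run w st p
  run-prefix []      st o p = ++-assoc o p st
  run-prefix (y ∷ w) st o p = pops-prefix y w st o p

  pops-prefix : ∀ y w st o p → pops y w st (o ++ p) ≡ o ++ pops y w st p
  pops-prefix y w []       o p = run-prefix w (y ∷ []) o p
  pops-prefix y w (t ∷ st) o p with y <ᵇ t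
  ... | true  = run-prefix w (y ∷ t ∷ st) o p
  ... | false = trans (cong (pops y w st) (++-assoc o p (t ∷ [])))
                      (pops-prefix y w st o (p ++ t ∷ []))

run-output : ∀ w st out → run w st out ≡ out ++ run w st []
run-output w st out =
  trans (cong (run w st) (sym (++-identityʳ out))) (run-prefix w st out [])

mutual
  run-All : ∀ {P : ℕ → Set} w st out →
    All P w → All P st → All P out → All P (run w st out)
  run-All []      st out []        Pst Pout = ++⁺ Pout Pst
  run-All (y ∷ w) st out (Py ∷ Pw) Pst Pout = pops-All y w st out Py Pw Pst Pout

  pops-All : ∀ {P : ℕ → Set} y w st out →
    P y → All P w → All P st → All P out → All P (pops y w st out)
  pops-All y w []       out Py Pw Pst Pout = run-All w (y ∷ []) out Pw (Py ∷ []) Pout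
  pops-All y w (t ∷ st) out Py Pw (Pt ∷ Pst) Pout with y <ᵇ t
  ... | true  = run-All w (y ∷ t ∷ st) out Pw (Py ∷ Pt ∷ Pst) Pout
  ... | false = pops-All y w st (out ++ t ∷ []) Py Pw Pst (++⁺ Pout (Pt ∷ []))

run-pop-top : ∀ {t} v st out → All (t <_) v →
  run v (t ∷ st) out ≡ run v st (out ++ t ∷ [])
run-pop-top     []      st out _ = sym (++-assoc out _ st)
run-pop-top {t} (y ∷ v) st out (t<y ∷ _) with y <ᵇ t | <ᵇ-reflects-< y t
... | true  | ofʸ y<t = contradiction y<t (<-asym t<y)
... | false | ofⁿ _   = refl

push-deletion : ∀ {x} v st out → All (x <_) st → All (x <_) v →
  RLMinDeletion x (run v st out) (run v (x ∷ st) out)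
push-deletion {x} v st out x<st x<v =
  split out (run v st []) x-popped (run-output v st out) (run-All v st [] x<v x<st [])
  where
  open ≡-Reasoning
  x-popped : run v (x ∷ st) out ≡ out ++ x ∷ run v st []
  x-popped = begin
    run v (x ∷ st) out                ≡⟨ run-pop-top v st out x<v ⟩
    run v st (out ++ x ∷ [])          ≡⟨ run-output v st _ ⟩
    (out ++ x ∷ []) ++ run v st []    ≡⟨ ++-assoc out _ _ ⟩
    out ++ x ∷ run v st []            ∎

arrive-deletion : ∀ {x} v st out → AllPairs _<_ st → All (x <_) v →
  RLMinDeletion x (run v st out) (pops x v st out)
arrive-deletion     v []       out _            x<v = push-deletion v [] out [] x<v
arrive-deletion {x} v (t ∷ st) out (t<st ∷ st↑) x<v with x <ᵇ t | <ᵇ-reflects-< x t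
... | true  | ofʸ x<t = push-deletion v (t ∷ st) out (x<t ∷ All.map (<-trans x<t) t<st) x<v
... | false | ofⁿ x≮t =
  subst (λ w′ → RLMinDeletion x w′ (pops x v st (out ++ t ∷ [])))
        (sym (run-pop-top v st out (All.map (≤-<-trans (≮⇒≥ x≮t)) x<v)))
        (arrive-deletion v st (out ++ t ∷ []) st↑ x<v)

mutual
  run-deletion : ∀ {x} u v st out → AllPairs _<_ st → All (x <_) v →
    RLMinDeletion x (run (u ++ v) st out) (run (u ++ x ∷ v) st out)
  run-deletion []      v st out st↑ x<v = arrive-deletion v st out st↑ x<v
  run-deletion (y ∷ u) v st out st↑ x<v = pops-deletion y u v st out st↑ x<v

  pops-deletion : ∀ {x} y u v st out → AllPairs _<_ st → All (x <_) v →
    RLMinDeletion x (pops y (u ++ v) st out) (pops y (u ++ x ∷ v) st out)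
  pops-deletion y u v [] out _ x<v = run-deletion u v (y ∷ []) out ([] ∷ []) x<v
  pops-deletion y u v (t ∷ st) out (t<st ∷ st↑) x<v with y <ᵇ t | <ᵇ-reflects-< y t
  ... | true  | ofʸ y<t =
    run-deletion u v (y ∷ t ∷ st) out ((y<t ∷ All.map (<-trans y<t) t<st) ∷ t<st ∷ st↑) x<v
  ... | false | ofⁿ _   = pops-deletion y u v st (out ++ t ∷ []) st↑ x<v

s-deletion : ∀ {x w′ w} → RLMinDeletion x w′ w → RLMinDeletion x (s w′) (s w)
s-deletion (split u v refl refl x<v) = run-deletion u v [] [] [] x<v

iter-s-deletion : ∀ k {x w′ w} →
  RLMinDeletion x w′ w → RLMinDeletion x (iter k s w′) (iter k s w)
iter-s-deletion zero    d = d
iter-s-deletion (suc k) d = s-deletion (iter-s-deletion k d)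

dropLast-snoc : ∀ w x → dropLast (w ++ x ∷ []) ≡ w
dropLast-snoc []          x = refl
dropLast-snoc (y ∷ [])    x = refl
dropLast-snoc (y ∷ z ∷ w) x = cong (y ∷_) (dropLast-snoc (z ∷ w) x)

lemma5p2 : (n : ℕ) (π : List ℕ) → π ↭ oneTo n → (k : ℕ) →
    iter k s (dropLast π) ⊆ iter k s π
lemma5p2 _ π _ k with initLast π
... | []       = ⊆-refl
... | w ∷ʳ′ x rewrite dropLast-snoc w x =
  RLMinDeletion⇒⊆ (iter-s-deletion k (split w [] refl (sym (++-identityʳ w)) []))
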